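{- If $(f,C)$ is a low-defect pair of degree $r$, then for all nonnegative integers $n_1,\dots,n_r$, $\|f(3^{n_1},\dots,3^{n_r})\|\le C+3(n_1+\dots+n_r).$
   Context: $\|n\|$ is the complexity of a positive integer $n$: the least number of $1$'s needed to write $n$ using $1$, $+$, $\times$ and parentheses. For polynomials $f_1$ in $x_1,\dots,x_{r_1}$ and $f_2$ in $x_1,\dots,x_{r_2}$, $(f_1\otimes f_2)(x_1,\dots,x_{r_1+r_2})=f_1(x_1,\dots,x_{r_1})f_2(x_{r_1+1},\dots,x_{r_1+r_2})$. The set of low-defect pairs is the smallest subset $\mathscr{P}\subseteq\mathbb{Z}[x_1,x_2,\dots]\times\mathbb{N}$ such that: (i) for each positive integer constant $k$ and integer $C\ge\|k\|$, $(k,C)\in\mathscr{P}$; (ii) if $(f_1,C_1),(f_2,C_2)\in\mathscr{P}$ then $(f_1\otimes f_2,C_1+C_2)\in\mathscr{P}$; (iii) if $(f,C)\in\mathscr{P}$ with $f$ in $x_1,\dots,x_r$, $c$ a positive integer and $D\ge\|c\|$, then $(f(x_1,\dots,x_r)x_{r+1}+c,C+D)\in\mathscr{P}$. The degree $r$ of a pair $(f,C)$ is the number of variables $x_1,\dots,x_r$ of $f$. -}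

module Defs where

open import Data.Nat using (ℕ; zero; suc; _+_; _*_; _≤_)
open import Data.Vec using (Vec; take; drop; init; last)
open import Data.Product using (Σ; _×_)
open import Relation.Binary.PropositionalEquality using (_≡_)

data Expr : Set where
  one : Expr
  _⊕_ : Expr → Expr → Expr
  _⊛_ : Expr → Expr → Expr

value : Expr → ℕ
value one = 1
value (e ⊕ e′) = value e + value e′
value (e ⊛ e′) = value e * value e′

ones : Expr → ℕ
ones one = 1
ones (e ⊕ e′) = ones e + ones e′
ones (e ⊛ e′) = ones e + ones e′

IsComplexity : ℕ → ℕ → Set
IsComplexity n m =
  (Σ Expr λ e → value e ≡ n × ones e ≡ m) × (∀ e → value e ≡ n → m ≤ ones e)

‖_‖≤_ : ℕ → ℕ → Set
‖ n ‖≤ C = ∀ m → IsComplexity n m → m ≤ C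

-- A polynomial in x₁,…,x_r is represented by
-- its evaluation function on ℕ^r (all low-defect polynomials have
-- nonnegative integer coefficients; only evaluations are used).
data LowDefect : (r : ℕ) → (Vec ℕ r → ℕ) → ℕ → Set where
  const  : ∀ (k C : ℕ) → 1 ≤ k → ‖ k ‖≤ C → LowDefect 0 (λ _ → k) C
  tensor : ∀ {r₁ r₂ f₁ f₂ C₁ C₂} →
           LowDefect r₁ f₁ C₁ → LowDefect r₂ f₂ C₂ →
           LowDefect (r₁ + r₂) (λ v → f₁ (take r₁ v) * f₂ (drop r₁ v)) (C₁ + C₂)
  extend : ∀ {r f C} (c D : ℕ) → LowDefect r f C → 1 ≤ c → ‖ c ‖≤ D →
           LowDefect (suc r) (λ v → f (init v) * last v + c) (C + D)

module Submission where

-- Call n "writable within C" if some expression in 1, + and × of value n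
-- uses at most C ones.  Writability is manifestly compatible with the
-- three rules generating low-defect pairs: products and sums of
-- expressions add their costs, and multiplying by 3^k costs 3k ones,
-- since 3 = 1 + 1 + 1.  So by induction on the low-defect pair, f(3^ns)
-- is writable within C + 3·Σns.
--
-- The only subtlety is translating between writability and the
-- hypothesis/conclusion ‖ n ‖≤ C, which speaks about the exact complexity:
-- extracting an expression from ‖ k ‖≤ C needs a minimal expression for k,
-- whose existence is classical.  We therefore run the induction in the
-- double-negation monad; this is harmless because ‖ n ‖≤ C is a
-- universally quantified decidable statement, hence ¬¬-stable.

open import Defs
open import Data.Nat using (ℕ; _+_; _*_; _^_)
open import Data.Vec using (Vec; map; sum)

open import Level using (0ℓ)
open import Data.Nat using (zero; suc; _≤_; _<_; _≤?_)
open import Data.Nat.Properties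
  using (≤-refl; ≤-trans; ≤-pred; <⇒≱; ≮⇒≥; m≤m+n; +-mono-≤; +-assoc;
         +-identityʳ; *-identityʳ; *-assoc; *-suc)
open import Data.Nat.Tactic.RingSolver using (solve-∀)
open import Data.Vec using (_∷_; []; _∷ʳ_; take; drop; init; last; initLast)
open import Data.Vec.Properties
  using (take-map; drop-map; take++drop≡id; sum-++; init-∷ʳ; last-∷ʳ; map-∷ʳ)
open import Data.Product using (Σ; _×_; _,_)
open import Effect.Monad using (RawMonad)
open import Relation.Nullary using (¬_; Dec; yes; no)
open import Relation.Nullary.Negation using (¬¬-Monad; ¬¬-map; contradiction)
open import Relation.Nullary.Decidable using (¬¬-excluded-middle; decidable-stable)
open import Relation.Binary.PropositionalEquality
  using (_≡_; refl; sym; trans; cong; cong₂; subst; subst₂)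

open RawMonad (¬¬-Monad {0ℓ}) using (pure; _>>=_)

Writable : ℕ → ℕ → Set
Writable n C = Σ Expr λ e → value e ≡ n × ones e ≤ C

ones-positive : ∀ e → 1 ≤ ones e
ones-positive one      = ≤-refl
ones-positive (e ⊕ e′) = ≤-trans (ones-positive e) (m≤m+n _ _)
ones-positive (e ⊛ e′) = ≤-trans (ones-positive e) (m≤m+n _ _)

writable-+ : ∀ {a b C₁ C₂} → Writable a C₁ → Writable b C₂ → Writable (a + b) (C₁ + C₂)
writable-+ (e₁ , v₁ , l₁) (e₂ , v₂ , l₂) = e₁ ⊕ e₂ , cong₂ _+_ v₁ v₂ , +-mono-≤ l₁ l₂

writable-* : ∀ {a b C₁ C₂} → Writable a C₁ → Writable b C₂ → Writable (a * b) (C₁ + C₂)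
writable-* (e₁ , v₁ , l₁) (e₂ , v₂ , l₂) = e₁ ⊛ e₂ , cong₂ _*_ v₁ v₂ , +-mono-≤ l₁ l₂

writable-3 : Writable 3 3
writable-3 = one ⊕ (one ⊕ one) , refl , ≤-refl

writable-*3^ : ∀ {a C} k → Writable a C → Writable (a * 3 ^ k) (C + 3 * k)
writable-*3^ {a} {C} zero w = subst₂ Writable (sym (*-identityʳ a)) (sym (+-identityʳ C)) w
writable-*3^ {a} {C} (suc k) w =
  subst₂ Writable (*-assoc a 3 (3 ^ k)) cost (writable-*3^ k (writable-* w writable-3))
  where
  cost : C + 3 + 3 * k ≡ C + 3 * suc k
  cost = trans (+-assoc C 3 (3 * k)) (cong (C +_) (sym (*-suc 3 k)))

unary : ∀ k → Σ Expr λ e → value e ≡ suc k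
unary zero    = one , refl
unary (suc k) with unary k
... | e , v = one ⊕ e , cong suc v

Optimal : ℕ → Expr → Set
Optimal n e = value e ≡ n × (∀ e′ → value e′ ≡ n → ones e ≤ ones e′)

-- Classically, any expression can be improved to an optimal one: keep
-- replacing it by a strictly cheaper one while possible (b bounds the cost).
optimal-exists : ∀ b n e → value e ≡ n → ones e ≤ b → ¬ ¬ Σ Expr (Optimal n)
optimal-exists zero    n e v le = contradiction le (<⇒≱ (ones-positive e))
optimal-exists (suc b) n e v le = ¬¬-excluded-middle >>= improve
  where
  improve : Dec (Σ Expr λ e′ → value e′ ≡ n × ones e′ < ones e) → ¬ ¬ Σ Expr (Optimal n)
  improve (yes (e′ , v′ , cheaper)) = optimal-exists b n e′ v′ (≤-pred (≤-trans cheaper le))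
  improve (no none-cheaper) =
    pure (e , v , λ e′ v′ → ≮⇒≥ (λ cheaper → none-cheaper (e′ , v′ , cheaper)))

bound⇒writable : ∀ k C → 1 ≤ k → ‖ k ‖≤ C → ¬ ¬ Writable k C
bound⇒writable (suc k) C _ bound with unary k
... | e₀ , v₀ = optimal-exists (ones e₀) (suc k) e₀ v₀ ≤-refl >>= λ
  { (e , v , optimal) → pure (e , v , bound (ones e) ((e , v , refl) , optimal)) }

-- Conversely an expression bounds the complexity; the conclusion is
-- decidable pointwise, so a double-negated expression suffices.
writable⇒bound : ∀ n C → ¬ ¬ Writable n C → ‖ n ‖≤ C
writable⇒bound n C w m (_ , minimal) =
  decidable-stable (m ≤? C) (¬¬-map (λ { (e , v , le) → ≤-trans (minimal e v) le }) w)

sum-take-drop : ∀ {n} m (ns : Vec ℕ (m + n)) → sum ns ≡ sum (take m ns) + sum (drop m ns)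
sum-take-drop m ns = trans (cong sum (sym (take++drop≡id m ns))) (sum-++ (take m ns))

sum-∷ʳ : ∀ {n} (xs : Vec ℕ n) x → sum (xs ∷ʳ x) ≡ sum xs + x
sum-∷ʳ []       x = +-identityʳ x
sum-∷ʳ (y ∷ xs) x = trans (cong (y +_) (sum-∷ʳ xs x)) (sym (+-assoc y (sum xs) x))

tensor-cost : ∀ C₁ C₂ s₁ s₂ → C₁ + 3 * s₁ + (C₂ + 3 * s₂) ≡ C₁ + C₂ + 3 * (s₁ + s₂)
tensor-cost = solve-∀

extend-cost : ∀ C D s x → C + 3 * s + 3 * x + D ≡ C + D + 3 * (s + x)
extend-cost = solve-∀

lowDefect-writable : ∀ {r f C} → LowDefect r f C →
  ∀ (ns : Vec ℕ r) → ¬ ¬ Writable (f (map (3 ^_) ns)) (C + 3 * sum ns)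
lowDefect-writable (const k C pos bound) [] =
  ¬¬-map (subst (Writable k) (sym (+-identityʳ C))) (bound⇒writable k C pos bound)
lowDefect-writable (tensor {r₁} {f₁ = f₁} {f₂} {C₁} {C₂} d₁ d₂) ns =
  lowDefect-writable d₁ (take r₁ ns) >>= λ w₁ →
  lowDefect-writable d₂ (drop r₁ ns) >>= λ w₂ →
  pure (subst₂ Writable value-eq cost-eq (writable-* w₁ w₂))
  where
  value-eq : f₁ (map (3 ^_) (take r₁ ns)) * f₂ (map (3 ^_) (drop r₁ ns))
           ≡ f₁ (take r₁ (map (3 ^_) ns)) * f₂ (drop r₁ (map (3 ^_) ns))
  value-eq = sym (cong₂ _*_ (cong f₁ (take-map (3 ^_) r₁ ns)) (cong f₂ (drop-map (3 ^_) r₁ ns)))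
  cost-eq : C₁ + 3 * sum (take r₁ ns) + (C₂ + 3 * sum (drop r₁ ns)) ≡ C₁ + C₂ + 3 * sum ns
  cost-eq = trans (tensor-cost C₁ C₂ (sum (take r₁ ns)) (sum (drop r₁ ns))) (cong (λ s → C₁ + C₂ + 3 * s) (sym (sum-take-drop r₁ ns)))
lowDefect-writable (extend {f = f} {C} c D d pos bound) ns with initLast ns
... | xs , x , refl
  rewrite map-∷ʳ (3 ^_) x xs | init-∷ʳ (3 ^ x) (map (3 ^_) xs) | last-∷ʳ (3 ^ x) (map (3 ^_) xs)
        | sum-∷ʳ xs x =
  lowDefect-writable d xs >>= λ w₁ →
  bound⇒writable c D pos bound >>= λ w₂ →
  pure (subst (Writable _) (extend-cost C D (sum xs) x) (writable-+ (writable-*3^ x w₁) w₂))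

proposition4p5 : ∀ (r : ℕ) (f : Vec ℕ r → ℕ) (C : ℕ) → LowDefect r f C →
    ∀ (ns : Vec ℕ r) → ‖ f (map (3 ^_) ns) ‖≤ (C + 3 * sum ns)
proposition4p5 r f C d ns = writable⇒bound _ _ (lowDefect-writable d ns)
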